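{- Let $k\ge 1$ and $s\ge 2$ be integers with $n=ks\ge 5$, let $F$ be a field, $\mathfrak P=PG(n-2,F)$, $q_0,\dots,q_{n-1}$ a projective frame of $\mathfrak P$, and $X=\{0,\dots,n-1\}$. Consider the map $a\mapsto p_a$ from the $k$-element subsets of $X$ to points of $\mathfrak P$. Then for every block $B$ of $\mathbf{CR}(X,k,s)$, the subspace $\overline{p(B)}$ of $\mathfrak P$ spanned by $\{p_a:a\in B\}$ has projective dimension $s-2$. Moreover, if $a$ is a point of $\mathbf{CR}(X,k,s)$ with $a\notin B$, then $p_a\notin\overline{p(B)}$; consequently distinct blocks are sent to distinct $(s-2)$-dimensional subspaces.
   Context: For $u\subseteq X$, $Q_u$ is the projective subspace spanned by $\{q_i:i\in u\}$; for every nonempty proper $a\subset X$, $Q_a\cap Q_{X\setminus a}$ is a single point, denoted $p_a$. $\mathbf{CR}(X,k,s)$ (with $|X|=ks$) is the incidence structure whose points are the $k$-element subsets of $X$ and whose blocks are the sets $\{a_1,\dots,a_s\}$ of pairwise disjoint $k$-subsets of $X$ (partitions of $X$ into $s$ parts of size $k$). Dimensions are projective dimensions. -}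

module Defs where

open import Level using (Level; _⊔_; suc)
open import Data.Nat using (ℕ; _∸_)
open import Data.Fin using (Fin)
open import Data.Fin.Subset using (Subset; ∣_∣; _∈_; _∉_; _∩_; ∁; Empty)
open import Data.Product using (Σ; ∃; _×_; _,_)
open import Relation.Nullary using (¬_)
open import Relation.Binary.PropositionalEquality using (_≡_; _≢_)
open import Algebra.Bundles using (CommutativeRing)

record Field (c ℓ : Level) : Set (Level.suc (c ⊔ ℓ)) where
  field
    commutativeRing : CommutativeRing c ℓ
  open CommutativeRing commutativeRing public
  field
    0≉1     : ¬ (0# ≈ 1#)
    inverse : ∀ x → ¬ (x ≈ 0#) → ∃ λ y → x * y ≈ 1#

module LinAlg {c ℓ : Level} (F : Field c ℓ) where
  open Field F using (Carrier; _≈_; 0#; _+_; _*_)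

  Vec : ℕ → Set c
  Vec d = Fin d → Carrier

  _≈ᵛ_ : ∀ {d} → Vec d → Vec d → Set ℓ
  u ≈ᵛ v = ∀ i → u i ≈ v i

  0ᵛ : ∀ {d} → Vec d
  0ᵛ i = 0#

  _+ᵛ_ : ∀ {d} → Vec d → Vec d → Vec d
  (u +ᵛ v) i = u i + v i

  _·_ : ∀ {d} → Carrier → Vec d → Vec d
  (x · v) i = x * v i

  lincomb : ∀ {d r} → (Fin r → Carrier) → (Fin r → Vec d) → Vec d
  lincomb {r = ℕ.zero}  cs w = 0ᵛ
  lincomb {r = ℕ.suc r} cs w = (cs Fin.zero · w Fin.zero) +ᵛ lincomb (λ i → cs (Fin.suc i)) (λ i → w (Fin.suc i))

  InSpan : ∀ {d r} → (Fin r → Vec d) → Vec d → Set (c ⊔ ℓ)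
  InSpan w v = ∃ λ cs → v ≈ᵛ lincomb cs w

  InSpanSub : ∀ {d r} → (Fin r → Vec d) → Subset r → Vec d → Set (c ⊔ ℓ)
  InSpanSub w a v = ∃ λ cs → (∀ i → i ∉ a → cs i ≈ 0#) × (v ≈ᵛ lincomb cs w)

  SameSpan : ∀ {d r r'} → (Fin r → Vec d) → (Fin r' → Vec d) → Set (c ⊔ ℓ)
  SameSpan w w' = (∀ i → InSpan w' (w i)) × (∀ j → InSpan w (w' j))

  LinIndep : ∀ {d r} → (Fin r → Vec d) → Set (c ⊔ ℓ)
  LinIndep w = ∀ cs → lincomb cs w ≈ᵛ 0ᵛ → ∀ i → cs i ≈ 0#

  HasDim : ∀ {d r} → (Fin r → Vec d) → ℕ → Set (c ⊔ ℓ)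
  HasDim {d} w m = Σ (Fin m → Vec d) λ b → LinIndep b × SameSpan b w

  HasProjDim : ∀ {d r} → (Fin r → Vec d) → ℕ → Set (c ⊔ ℓ)
  HasProjDim w e = HasDim w (ℕ.suc e)

  -- q : Fin (d+2) → F^(d+1) represents a projective frame of PG(d,F):
  -- any d+1 of the d+2 points are independent, i.e. for each j the
  -- family (q i)_{i ≠ j} is linearly independent.
  IsFrame : ∀ {n} → (Fin n → Vec (n ∸ 1)) → Set (c ⊔ ℓ)
  IsFrame q = ∀ j cs → cs j ≈ 0# → lincomb cs q ≈ᵛ 0ᵛ → ∀ i → cs i ≈ 0#

  -- v is a (nonzero) representative vector of the point p_a = Q_a ∩ Q_{X∖a}
  RepresentsP : ∀ {n} → (Fin n → Vec (n ∸ 1)) → Subset n → Vec (n ∸ 1) → Set (c ⊔ ℓ)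
  RepresentsP q a v = ¬ (v ≈ᵛ 0ᵛ) × InSpanSub q a v × InSpanSub q (∁ a) v

IsBlock : ∀ {n} (k s : ℕ) → (Fin s → Subset n) → Set
IsBlock k s B = (∀ i → ∣ B i ∣ ≡ k) × (∀ i j → i ≢ j → Empty (B i ∩ B j))

module Submission where

-- Work with coordinate vectors c : Fin n → F and L c = Σ c_t q_t.  Because q is a
-- frame, the kernel of L is a line spanned by a vector r with every r_t ≠ 0, and
-- every representative of p_a is L(μ·r|_a) for a scalar μ ≠ 0 (Restriction).  For
-- a block B = {B_0, ..., B_{s-1}} (a partition of X) write p(B_i) = L(μ_i·r|_{B_i}).
--   * Σ μ_i⁻¹ p(B_i) = L r = 0, so p(B_0) is a combination of the others;
--   * if Σ x_i p(B_i) = 0 then Σ x_i μ_i r|_{B_i} = ν r, so all x_i μ_i equal ν;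
--     hence p(B_1), ..., p(B_{s-1}) are independent and form a basis (dimension s-1);
--   * if p_a = Σ x_i p(B_i) and t ∈ a ∩ B_i, comparing coefficients on B_i forces
--     B_i ⊆ a, so a = B_i by cardinality.

open import Defs
open import Level using (Level; _⊔_)
open import Data.Nat using (ℕ; zero; suc; _∸_; _≤_; z≤n; s≤s)
open import Data.Nat using () renaming (_*_ to _ℕ*_)
open import Data.Bool using (true; false)
import Data.Bool as Bool
open import Data.Vec using (_∷_; []; here)
open import Data.Vec.Properties using (≡-dec)
open import Data.Fin using (Fin; _≟_)
open import Data.Fin.Properties using (suc-injective; any?)
open import Data.Fin.Subset using (Subset; ∣_∣; _∈_; _∉_; _∩_; _∪_; ∁; ⊥; ⊤; _⊆_; Empty; Nonempty)
open import Data.Fin.Subset.Properties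
  using ( _∈?_; drop-∷-Empty; Empty-unique; nonempty?; ∉⊥; ∈⊤; ∣⊥∣≡0; ∣p∣≡n⇒p≡⊤
        ; ⊆-antisym; p⊂q⇒∣p∣<∣q∣; x∈p⇒x∉∁p; x∈p∩q⁺; x∈p∩q⁻; x∈p∪q⁻ )
open import Data.Product using (∃; _×_; _,_; proj₁; proj₂)
open import Data.Sum using (inj₁; inj₂)
open import Data.Empty using (⊥-elim)
open import Relation.Nullary using (¬_; yes; no)
open import Relation.Binary.PropositionalEquality using (_≡_; _≢_)
import Relation.Binary.PropositionalEquality as ≡

module Partitions where
  open import Data.Nat using (_+_; _*_)
  open import Data.Nat.Properties using (+-suc; *-comm; <-irrefl)

  Disjoint : ∀ {n s} → (Fin s → Subset n) → Set
  Disjoint B = ∀ i j → i ≢ j → Empty (B i ∩ B j)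

  union : ∀ {n s} → (Fin s → Subset n) → Subset n
  union {s = zero}  B = ⊥
  union {s = suc s} B = B Fin.zero ∪ union (λ i → B (Fin.suc i))

  ∈union⁻ : ∀ {n s} (B : Fin s → Subset n) {t} → t ∈ union B → ∃ λ i → t ∈ B i
  ∈union⁻ {s = zero}  B t∈ = ⊥-elim (∉⊥ t∈)
  ∈union⁻ {s = suc s} B t∈ with x∈p∪q⁻ (B Fin.zero) _ t∈
  ... | inj₁ t∈B₀ = Fin.zero , t∈B₀
  ... | inj₂ t∈rest with ∈union⁻ (λ i → B (Fin.suc i)) t∈rest
  ... | i , t∈Bi = Fin.suc i , t∈Bi

  ∣∪∣-disjoint : ∀ {n} (a b : Subset n) → Empty (a ∩ b) → ∣ a ∪ b ∣ ≡ ∣ a ∣ + ∣ b ∣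
  ∣∪∣-disjoint []          []          _ = ≡.refl
  ∣∪∣-disjoint (true ∷ a)  (true ∷ b)  e = ⊥-elim (e (Fin.zero , here))
  ∣∪∣-disjoint (true ∷ a)  (false ∷ b) e = ≡.cong suc (∣∪∣-disjoint a b (drop-∷-Empty e))
  ∣∪∣-disjoint (false ∷ a) (true ∷ b)  e =
    ≡.trans (≡.cong suc (∣∪∣-disjoint a b (drop-∷-Empty e))) (≡.sym (+-suc ∣ a ∣ ∣ b ∣))
  ∣∪∣-disjoint (false ∷ a) (false ∷ b) e = ∣∪∣-disjoint a b (drop-∷-Empty e)

  ∣union∣ : ∀ {n s k} (B : Fin s → Subset n) → Disjoint B → (∀ i → ∣ B i ∣ ≡ k) →
    ∣ union B ∣ ≡ s * k
  ∣union∣ {n} {zero} B _ _ = ∣⊥∣≡0 n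
  ∣union∣ {s = suc s} B disj size =
    ≡.trans (∣∪∣-disjoint (B Fin.zero) _ head-apart)
            (≡.cong₂ _+_ (size Fin.zero) (∣union∣ (λ i → B (Fin.suc i)) tail-disj (λ i → size (Fin.suc i))))
    where
    tail-disj : Disjoint (λ i → B (Fin.suc i))
    tail-disj i j i≢j = disj (Fin.suc i) (Fin.suc j) (λ e → i≢j (suc-injective e))
    head-apart : Empty (B Fin.zero ∩ union (λ i → B (Fin.suc i)))
    head-apart (t , t∈∩) with x∈p∩q⁻ (B Fin.zero) _ t∈∩
    ... | t∈B₀ , t∈rest with ∈union⁻ (λ i → B (Fin.suc i)) t∈rest
    ... | i , t∈Bi = disj Fin.zero (Fin.suc i) (λ ()) (t , x∈p∩q⁺ (t∈B₀ , t∈Bi))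

  partition-covers : ∀ {n s k} (B : Fin s → Subset n) → Disjoint B → (∀ i → ∣ B i ∣ ≡ k) →
    n ≡ k * s → ∀ t → ∃ λ i → t ∈ B i
  partition-covers {s = s} {k} B disj size n≡ks t =
    ∈union⁻ B (≡.subst (t ∈_) (≡.sym union≡⊤) ∈⊤)
    where
    union≡⊤ : union B ≡ ⊤
    union≡⊤ = ∣p∣≡n⇒p≡⊤ (≡.trans (∣union∣ B disj size) (≡.trans (*-comm s k) (≡.sym n≡ks)))

  part-unique : ∀ {n s} (B : Fin s → Subset n) → Disjoint B → ∀ {t i j} → t ∈ B i → t ∈ B j → i ≡ j
  part-unique B disj {t} {i} {j} t∈Bi t∈Bj with i ≟ j
  ... | yes i≡j = i≡j
  ... | no i≢j = ⊥-elim (disj i j i≢j (t , x∈p∩q⁺ (t∈Bi , t∈Bj)))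

  inhabited : ∀ {n k} → 1 ≤ k → (a : Subset n) → ∣ a ∣ ≡ k → Nonempty a
  inhabited {n} k≥1 a |a|≡k with nonempty? a
  ... | yes ne = ne
  ... | no empty with ≡.trans (≡.sym |a|≡k) (≡.trans (≡.cong ∣_∣ (Empty-unique empty)) (∣⊥∣≡0 n))
  inhabited (s≤s z≤n) a |a|≡k | no empty | ()

  ⊆-same-size : ∀ {n} {a b : Subset n} → a ⊆ b → ∣ a ∣ ≡ ∣ b ∣ → a ≡ b
  ⊆-same-size {a = a} {b} a⊆b |a|≡|b| = ⊆-antisym a⊆b b⊆a
    where
    b⊆a : b ⊆ a
    b⊆a {t} t∈b with t ∈? a
    ... | yes t∈a = t∈a
    ... | no t∉a = ⊥-elim (<-irrefl |a|≡|b| (p⊂q⇒∣p∣<∣q∣ (a⊆b , t , t∈b , t∉a)))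

open Partitions

module FieldArithmetic {c ℓ} (F : Field c ℓ) where
  open Field F
  open import Algebra.Properties.Ring ring public
    using (-‿distribˡ-*; -‿distribʳ-*; -1*x≈-x; -‿involutive; +-inverseʳ-unique; x∙y⁻¹≈ε⇒x≈y; x≈y⇒x∙y⁻¹≈ε)
  open import Relation.Binary.Reasoning.Setoid setoid

  divide : ∀ {y} → ¬ (y ≈ 0#) → ∀ x → ∃ λ ν → ν * y ≈ x
  divide {y} y≉0 x with inverse y y≉0
  ... | y⁻¹ , yy⁻¹≈1 = x * y⁻¹ , (begin
    (x * y⁻¹) * y ≈⟨ *-assoc x y⁻¹ y ⟩
    x * (y⁻¹ * y) ≈⟨ *-congˡ (trans (*-comm y⁻¹ y) yy⁻¹≈1) ⟩
    x * 1#        ≈⟨ *-identityʳ x ⟩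
    x             ∎)

  inverse-cancel : ∀ {ι μ} z → ι * μ ≈ 1# → ι * (μ * z) ≈ z
  inverse-cancel {ι} {μ} z ιμ≈1 = begin
    ι * (μ * z) ≈⟨ *-assoc ι μ z ⟨
    (ι * μ) * z ≈⟨ *-congʳ ιμ≈1 ⟩
    1# * z      ≈⟨ *-identityˡ z ⟩
    z           ∎

  cancel-nonzeroʳ : ∀ {x y} → ¬ (y ≈ 0#) → x * y ≈ 0# → x ≈ 0#
  cancel-nonzeroʳ {x} {y} y≉0 xy≈0 with divide y≉0 1#
  ... | ι , ιy≈1 = begin
    x             ≈⟨ inverse-cancel x ιy≈1 ⟨
    ι * (y * x)   ≈⟨ *-congˡ (*-comm y x) ⟩
    ι * (x * y)   ≈⟨ *-congˡ xy≈0 ⟩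
    ι * 0#        ≈⟨ zeroʳ ι ⟩
    0#            ∎

  nonzero-* : ∀ {x y} → ¬ (x ≈ 0#) → ¬ (y ≈ 0#) → ¬ (x * y ≈ 0#)
  nonzero-* x≉0 y≉0 xy≈0 = x≉0 (cancel-nonzeroʳ y≉0 xy≈0)

  *-cancelʳ : ∀ {x y z} → ¬ (z ≈ 0#) → x * z ≈ y * z → x ≈ y
  *-cancelʳ {x} {y} {z} z≉0 xz≈yz = x∙y⁻¹≈ε⇒x≈y x y (cancel-nonzeroʳ z≉0 (begin
    (x - y) * z       ≈⟨ distribʳ z x (- y) ⟩
    x * z + - y * z   ≈⟨ +-congˡ (-‿distribˡ-* y z) ⟨
    x * z - y * z     ≈⟨ x≈y⇒x∙y⁻¹≈ε xz≈yz ⟩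
    0#                ∎))

  move-right : ∀ {x y z} → x - y ≈ z → x ≈ z + y
  move-right {x} {y} {z} x-y≈z = begin
    x             ≈⟨ +-identityʳ x ⟨
    x + 0#        ≈⟨ +-congˡ (-‿inverseˡ y) ⟨
    x + (- y + y) ≈⟨ +-assoc x (- y) y ⟨
    (x - y) + y   ≈⟨ +-congʳ x-y≈z ⟩
    z + y         ∎

  isolate : ∀ {ι μ u c} → ι * μ ≈ 1# → ι * u + c ≈ 0# → u ≈ - μ * c
  isolate {ι} {μ} {u} {c} ιμ≈1 ιu+c≈0 = sym (begin
    - μ * c            ≈⟨ -‿distribˡ-* μ c ⟨
    - (μ * c)          ≈⟨ -‿cong (*-congˡ (+-inverseʳ-unique (ι * u) c ιu+c≈0)) ⟩
    - (μ * - (ι * u))  ≈⟨ -‿cong (-‿distribʳ-* μ (ι * u)) ⟨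
    - - (μ * (ι * u))  ≈⟨ -‿involutive (μ * (ι * u)) ⟩
    μ * (ι * u)        ≈⟨ inverse-cancel u (trans (*-comm μ ι) ιμ≈1) ⟩
    u                  ∎)

module LinearCombinations {c ℓ} (F : Field c ℓ) where
  open Field F
  open LinAlg F
  open FieldArithmetic F
  open import Algebra.Properties.CommutativeSemigroup +-commutativeSemigroup using (interchange)
  open import Relation.Binary.Reasoning.Setoid setoid

  _-ᵛ_ : ∀ {d} → Vec d → Vec d → Vec d
  (u -ᵛ v) i = u i - v i

  lincomb-cong : ∀ {d r} {cs ds : Fin r → Carrier} (w : Fin r → Vec d) →
    (∀ i → cs i ≈ ds i) → lincomb cs w ≈ᵛ lincomb ds w
  lincomb-cong {r = zero}  w e t = refl
  lincomb-cong {r = suc r} w e t =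
    +-cong (*-congʳ (e Fin.zero)) (lincomb-cong (λ i → w (Fin.suc i)) (λ i → e (Fin.suc i)) t)

  lincomb-congʷ : ∀ {d r} (cs : Fin r → Carrier) {w w' : Fin r → Vec d} →
    (∀ i → w i ≈ᵛ w' i) → lincomb cs w ≈ᵛ lincomb cs w'
  lincomb-congʷ {r = zero}  cs e t = refl
  lincomb-congʷ {r = suc r} cs e t =
    +-cong (*-congˡ (e Fin.zero t)) (lincomb-congʷ (λ i → cs (Fin.suc i)) (λ i → e (Fin.suc i)) t)

  lincomb-+ : ∀ {d r} (cs ds : Fin r → Carrier) (w : Fin r → Vec d) →
    lincomb (cs +ᵛ ds) w ≈ᵛ (lincomb cs w +ᵛ lincomb ds w)
  lincomb-+ {r = zero}  cs ds w t = sym (+-identityʳ 0#)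
  lincomb-+ {r = suc r} cs ds w t = begin
    (cs₀ + ds₀) * w₀ + R (cs' +ᵛ ds')       ≈⟨ +-cong (distribʳ w₀ cs₀ ds₀) (lincomb-+ cs' ds' w' t) ⟩
    (cs₀ * w₀ + ds₀ * w₀) + (R cs' + R ds') ≈⟨ interchange (cs₀ * w₀) (ds₀ * w₀) (R cs') (R ds') ⟩
    (cs₀ * w₀ + R cs') + (ds₀ * w₀ + R ds') ∎
    where
    cs₀ = cs Fin.zero
    ds₀ = ds Fin.zero
    w₀ = w Fin.zero t
    cs' = λ i → cs (Fin.suc i)
    ds' = λ i → ds (Fin.suc i)
    w' = λ i → w (Fin.suc i)
    R : (Fin r → Carrier) → Carrier
    R es = lincomb es w' t

  lincomb-· : ∀ {d r} (x : Carrier) (cs : Fin r → Carrier) (w : Fin r → Vec d) →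
    lincomb (x · cs) w ≈ᵛ (x · lincomb cs w)
  lincomb-· {r = zero}  x cs w t = sym (zeroʳ x)
  lincomb-· {r = suc r} x cs w t = begin
    (x * cs Fin.zero) * w Fin.zero t + lincomb (x · cs') w' t
      ≈⟨ +-cong (*-assoc x _ _) (lincomb-· x cs' w' t) ⟩
    x * (cs Fin.zero * w Fin.zero t) + x * lincomb cs' w' t
      ≈⟨ distribˡ x _ _ ⟨
    x * (cs Fin.zero * w Fin.zero t + lincomb cs' w' t) ∎
    where
    cs' = λ i → cs (Fin.suc i)
    w' = λ i → w (Fin.suc i)

  lincomb-equal⇒difference : ∀ {d r} {u v : Fin r → Carrier} (w : Fin r → Vec d) →
    lincomb u w ≈ᵛ lincomb v w → lincomb (u -ᵛ v) w ≈ᵛ 0ᵛ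
  lincomb-equal⇒difference {u = u} {v} w Lu≈Lv t = begin
    lincomb (u -ᵛ v) w t                         ≈⟨ lincomb-cong w (λ i → +-congˡ (-1*x≈-x (v i))) t ⟨
    lincomb (u +ᵛ ((- 1#) · v)) w t              ≈⟨ lincomb-+ u ((- 1#) · v) w t ⟩
    lincomb u w t + lincomb ((- 1#) · v) w t     ≈⟨ +-congˡ (lincomb-· (- 1#) v w t) ⟩
    lincomb u w t + - 1# * lincomb v w t         ≈⟨ +-congˡ (-1*x≈-x _) ⟩
    lincomb u w t - lincomb v w t                ≈⟨ x≈y⇒x∙y⁻¹≈ε (Lu≈Lv t) ⟩
    0#                                           ∎

  lincomb-vanishes : ∀ {d r} (cs : Fin r → Carrier) (w : Fin r → Vec d) t →
    (∀ j → cs j * w j t ≈ 0#) → lincomb cs w t ≈ 0#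
  lincomb-vanishes {r = zero}  cs w t e = refl
  lincomb-vanishes {r = suc r} cs w t e =
    trans (+-cong (e Fin.zero) (lincomb-vanishes (λ i → cs (Fin.suc i)) (λ i → w (Fin.suc i)) t (λ i → e (Fin.suc i))))
          (+-identityʳ 0#)

  lincomb-zero : ∀ {d r} (cs : Fin r → Carrier) (w : Fin r → Vec d) →
    (∀ i → cs i ≈ 0#) → lincomb cs w ≈ᵛ 0ᵛ
  lincomb-zero cs w cs≈0 t = lincomb-vanishes cs w t (λ j → trans (*-congʳ (cs≈0 j)) (zeroˡ _))

  lincomb-single : ∀ {d r} (cs : Fin r → Carrier) (w : Fin r → Vec d) t i →
    (∀ j → j ≢ i → cs j * w j t ≈ 0#) → lincomb cs w t ≈ cs i * w i t
  lincomb-single cs w t Fin.zero others =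
    trans (+-congˡ (lincomb-vanishes (λ j → cs (Fin.suc j)) (λ j → w (Fin.suc j)) t (λ j → others (Fin.suc j) (λ ()))))
          (+-identityʳ _)
  lincomb-single cs w t (Fin.suc i) others =
    trans (+-cong (others Fin.zero (λ ()))
                  (lincomb-single (λ j → cs (Fin.suc j)) (λ j → w (Fin.suc j)) t i
                                  (λ j j≢i → others (Fin.suc j) (λ e → j≢i (suc-injective e)))))
          (+-identityˡ _)

  lincomb-lincomb : ∀ {d m r} (cs : Fin r → Carrier) (E : Fin r → Vec m) (w : Fin m → Vec d) →
    lincomb cs (λ i → lincomb (E i) w) ≈ᵛ lincomb (lincomb cs E) w
  lincomb-lincomb {r = zero}  cs E w t = sym (lincomb-zero 0ᵛ w (λ _ → refl) t)
  lincomb-lincomb {r = suc r} cs E w t = begin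
    cs₀ * lincomb (E Fin.zero) w t + lincomb cs' (λ i → lincomb (E' i) w) t
      ≈⟨ +-cong (sym (lincomb-· cs₀ (E Fin.zero) w t)) (lincomb-lincomb cs' E' w t) ⟩
    lincomb (cs₀ · E Fin.zero) w t + lincomb (lincomb cs' E') w t
      ≈⟨ lincomb-+ (cs₀ · E Fin.zero) (lincomb cs' E') w t ⟨
    lincomb ((cs₀ · E Fin.zero) +ᵛ lincomb cs' E') w t ∎
    where
    cs₀ = cs Fin.zero
    cs' = λ i → cs (Fin.suc i)
    E' = λ i → E (Fin.suc i)

  unit : ∀ {r} → Fin r → Fin r → Carrier
  unit j i with i ≟ j
  ... | yes _ = 1#
  ... | no _ = 0#

  member-inSpan : ∀ {d r} (w : Fin r → Vec d) j → InSpan w (w j)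
  member-inSpan w j = unit j , λ t → sym (trans (lincomb-single (unit j) w t j others) unit-at-j)
    where
    others : ∀ {t} i → i ≢ j → unit j i * w i t ≈ 0#
    others i i≢j with i ≟ j
    ... | yes i≡j = ⊥-elim (i≢j i≡j)
    ... | no _ = zeroˡ _
    unit-at-j : ∀ {t} → unit j j * w j t ≈ w j t
    unit-at-j with j ≟ j
    ... | yes _ = *-identityˡ _
    ... | no j≢j = ⊥-elim (j≢j ≡.refl)

module FrameKernel {c ℓ} (F : Field c ℓ) {n : ℕ} (q : Fin n → LinAlg.Vec F (n ∸ 1))
                   (frame : LinAlg.IsFrame F q) where
  open Field F
  open LinAlg F
  open FieldArithmetic F
  open LinearCombinations F

  L : Vec n → Vec (n ∸ 1)
  L cs = lincomb cs q

  record KernelVector (r : Vec n) : Set ℓ where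
    field
      annihilated  : L r ≈ᵛ 0ᵛ
      nowhere-zero : ∀ t → ¬ (r t ≈ 0#)
  open KernelVector

  -- Every relation among the frame points is a multiple of r
  -- (any coordinate j serves as pivot, since the frame has no relation vanishing at j).
  kernel-line : ∀ {r} → KernelVector r → Fin n → ∀ {g} → L g ≈ᵛ 0ᵛ → ∃ λ ν → ∀ t → g t ≈ ν * r t
  kernel-line {r} K j {g} Lg≈0 = ν , λ t → x∙y⁻¹≈ε⇒x≈y (g t) (ν * r t) (g-νr≈0 t)
    where
    quotient : ∃ λ ν → ν * r j ≈ g j
    quotient = divide (nowhere-zero K j) (g j)
    ν : Carrier
    ν = proj₁ quotient
    Lνr≈0 : L (ν · r) ≈ᵛ 0ᵛ
    Lνr≈0 t = trans (lincomb-· ν r q t) (trans (*-congˡ (annihilated K t)) (zeroʳ ν))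
    g-νr≈0 : ∀ t → g t - ν * r t ≈ 0#
    g-νr≈0 = frame j (g -ᵛ (ν · r)) (x≈y⇒x∙y⁻¹≈ε (sym (proj₂ quotient)))
               (lincomb-equal⇒difference q (λ t → trans (Lg≈0 t) (sym (Lνr≈0 t))))

  support-nonzero : ∀ {a v cv} → ¬ (v ≈ᵛ 0ᵛ) → (∀ t → t ∉ a → cv t ≈ 0#) → v ≈ᵛ L cv →
    ¬ (∀ t → t ∈ a → cv t ≈ 0#)
  support-nonzero {a} {v} {cv} v≉0 off v≈Lcv on = v≉0 (λ i → trans (v≈Lcv i) (lincomb-zero cv q all-zero i))
    where
    all-zero : ∀ t → cv t ≈ 0#
    all-zero t with t ∈? a
    ... | yes t∈a = on t t∈a
    ... | no t∉a = off t t∉a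

  -- A representative of p_a, written once over a and once over X∖a, gives a
  -- kernel vector: the difference of the two coefficient vectors.
  kernelVector : ∀ {a v} → RepresentsP q a v → ∃ KernelVector
  kernelVector {a} (v≉0 , (cv , cv-off , v≈Lcv) , (dv , dv-off , v≈Ldv)) =
    cv -ᵛ dv , record { annihilated = Lr≈0 ; nowhere-zero = r-nonzero }
    where
    Lr≈0 : L (cv -ᵛ dv) ≈ᵛ 0ᵛ
    Lr≈0 = lincomb-equal⇒difference q (λ t → trans (sym (v≈Lcv t)) (v≈Ldv t))
    r-nonzero : ∀ j → ¬ (cv j - dv j ≈ 0#)
    r-nonzero j rj≈0 = support-nonzero v≉0 cv-off v≈Lcv cv-on
      where
      cv-on : ∀ t → t ∈ a → cv t ≈ 0#
      cv-on t t∈a = trans (x∙y⁻¹≈ε⇒x≈y _ _ (frame j (cv -ᵛ dv) rj≈0 Lr≈0 t)) (dv-off t (x∈p⇒x∉∁p t∈a))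

  record Restriction (r : Vec n) (a : Subset n) (v : Vec (n ∸ 1)) : Set (c ⊔ ℓ) where
    field
      μ          : Carrier
      μ≉0        : ¬ (μ ≈ 0#)
      coeff      : Vec n
      represents : v ≈ᵛ L coeff
      inside     : ∀ t → t ∈ a → coeff t ≈ μ * r t
      outside    : ∀ t → t ∉ a → coeff t ≈ 0#

  restriction : ∀ {r a v} → KernelVector r → Fin n → RepresentsP q a v → Restriction r a v
  restriction {r} {a} K j (v≉0 , (cv , cv-off , v≈Lcv) , (dv , dv-off , v≈Ldv)) = record
    { μ = ν ; μ≉0 = ν≉0 ; coeff = cv ; represents = v≈Lcv ; inside = inside ; outside = cv-off }
    where
    difference : ∃ λ ν → ∀ t → cv t - dv t ≈ ν * r t
    difference = kernel-line K j (lincomb-equal⇒difference q (λ t → trans (sym (v≈Lcv t)) (v≈Ldv t)))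
    ν = proj₁ difference
    inside : ∀ t → t ∈ a → cv t ≈ ν * r t
    inside t t∈a = trans (move-right (proj₂ difference t))
                         (trans (+-congˡ (dv-off t (x∈p⇒x∉∁p t∈a))) (+-identityʳ _))
    ν≉0 : ¬ (ν ≈ 0#)
    ν≉0 ν≈0 = support-nonzero v≉0 cv-off v≈Lcv (λ t t∈a → trans (inside t t∈a) (trans (*-congʳ ν≈0) (zeroˡ _)))

module Configuration {c ℓ} (F : Field c ℓ) {n : ℕ} (q : Fin n → LinAlg.Vec F (n ∸ 1))
    (frame : LinAlg.IsFrame F q) (k : ℕ) (k≥1 : 1 ≤ k) (p : Subset n → LinAlg.Vec F (n ∸ 1))
    (rep : ∀ a → ∣ a ∣ ≡ k → LinAlg.RepresentsP F q a (p a)) where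
  open Field F
  open LinAlg F
  open FieldArithmetic F
  open LinearCombinations F
  open FrameKernel F q frame
  open KernelVector
  open Restriction
  open import Relation.Binary.Reasoning.Setoid setoid

  module Block {s} (n≡ks : n ≡ k ℕ* suc s) (B : Fin (suc s) → Subset n) (blk : IsBlock k (suc s) B) where
    pB : Fin (suc s) → Vec (n ∸ 1)
    pB i = p (B i)

    covers : ∀ t → ∃ λ i → t ∈ B i
    covers = partition-covers B (proj₂ blk) (proj₁ blk) n≡ks

    pivot : Fin n
    pivot = proj₁ (inhabited k≥1 (B Fin.zero) (proj₁ blk Fin.zero))

    kernel : ∃ KernelVector
    kernel = kernelVector (rep (B Fin.zero) (proj₁ blk Fin.zero))

    r : Vec n
    r = proj₁ kernel

    K : KernelVector r
    K = proj₂ kernel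

    restrict : ∀ a → ∣ a ∣ ≡ k → Restriction r a (p a)
    restrict a |a|≡k = restriction K pivot (rep a |a|≡k)

    RB : ∀ i → Restriction r (B i) (pB i)
    RB i = restrict (B i) (proj₁ blk i)

    G : (Fin (suc s) → Carrier) → Vec n
    G x = lincomb x (λ i → coeff (RB i))

    span-coefficients : ∀ x → lincomb x pB ≈ᵛ L (G x)
    span-coefficients x t =
      trans (lincomb-congʷ x (λ i → represents (RB i)) t) (lincomb-lincomb x (λ i → coeff (RB i)) q t)

    G-on-part : ∀ x {t} i → t ∈ B i → G x t ≈ x i * (μ (RB i) * r t)
    G-on-part x {t} i t∈Bi =
      trans (lincomb-single x (λ j → coeff (RB j)) t i other-parts) (*-congˡ (inside (RB i) t t∈Bi))
      where
      other-parts : ∀ j → j ≢ i → x j * coeff (RB j) t ≈ 0#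
      other-parts j j≢i =
        trans (*-congˡ (outside (RB j) t (λ t∈Bj → j≢i (part-unique B (proj₂ blk) t∈Bj t∈Bi)))) (zeroʳ _)

    relation-uniform : ∀ x → lincomb x pB ≈ᵛ 0ᵛ → ∃ λ ν → ∀ i → x i * μ (RB i) ≈ ν
    relation-uniform x rel = ν , uniform
      where
      line = kernel-line K pivot (λ t → trans (sym (span-coefficients x t)) (rel t))
      ν = proj₁ line
      uniform : ∀ i → x i * μ (RB i) ≈ ν
      uniform i with inhabited k≥1 (B i) (proj₁ blk i)
      ... | t , t∈Bi = *-cancelʳ (nowhere-zero K t) (begin
        (x i * μ (RB i)) * r t ≈⟨ *-assoc (x i) _ (r t) ⟩
        x i * (μ (RB i) * r t) ≈⟨ G-on-part x i t∈Bi ⟨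
        G x t                  ≈⟨ proj₂ line t ⟩
        ν * r t                ∎)

    -- No other k-subset a has p_a in the span of the block:
    -- a part B_i meeting a would have to be contained in a.
    notInSpan : ∀ a → ∣ a ∣ ≡ k → (∀ i → a ≢ B i) → ¬ InSpan pB (p a)
    notInSpan a |a|≡k a≢B (x , pa≈) = a≢B i (≡.sym (⊆-same-size Bi⊆a (≡.trans (proj₁ blk i) (≡.sym |a|≡k))))
      where
      Ra = restrict a |a|≡k
      t₁ = proj₁ (inhabited k≥1 a |a|≡k)
      i = proj₁ (covers t₁)
      line : ∃ λ ν → ∀ t → coeff Ra t - G x t ≈ ν * r t
      line = kernel-line K pivot (lincomb-equal⇒difference q
               (λ t → trans (sym (represents Ra t)) (trans (pa≈ t) (span-coefficients x t))))
      ν = proj₁ line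
      y = ν + x i * μ (RB i)
      on-part : ∀ {t} → t ∈ B i → coeff Ra t ≈ y * r t
      on-part {t} t∈Bi = begin
        coeff Ra t                         ≈⟨ move-right (proj₂ line t) ⟩
        ν * r t + G x t                    ≈⟨ +-congˡ (G-on-part x i t∈Bi) ⟩
        ν * r t + x i * (μ (RB i) * r t)   ≈⟨ +-congˡ (*-assoc (x i) _ (r t)) ⟨
        ν * r t + (x i * μ (RB i)) * r t   ≈⟨ distribʳ (r t) ν _ ⟨
        y * r t                            ∎
      Bi⊆a : B i ⊆ a
      Bi⊆a {t} t∈Bi with t ∈? a
      ... | yes t∈a = t∈a
      ... | no t∉a = ⊥-elim (nonzero-* (μ≉0 Ra) (nowhere-zero K t₁) (begin
          μ Ra * r t₁   ≈⟨ inside Ra t₁ (proj₂ (inhabited k≥1 a |a|≡k)) ⟨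
          coeff Ra t₁   ≈⟨ on-part (proj₂ (covers t₁)) ⟩
          y * r t₁      ≈⟨ *-congʳ y≈0 ⟩
          0# * r t₁     ≈⟨ zeroˡ _ ⟩
          0#            ∎))
        where
        y≈0 : y ≈ 0#
        y≈0 = cancel-nonzeroʳ (nowhere-zero K t) (trans (sym (on-part t∈Bi)) (outside Ra t t∉a))

  module LargeBlock {m} (n≡ks : n ≡ k ℕ* suc (suc m)) (B : Fin (suc (suc m)) → Subset n)
                    (blk : IsBlock k (suc (suc m)) B) where
    open Block n≡ks B blk

    basis : Fin (suc m) → Vec (n ∸ 1)
    basis i = pB (Fin.suc i)

    μ⁻¹ : Fin (suc (suc m)) → Carrier
    μ⁻¹ i = proj₁ (divide (μ≉0 (RB i)) 1#)

    μ⁻¹-inverse : ∀ i → μ⁻¹ i * μ (RB i) ≈ 1#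
    μ⁻¹-inverse i = proj₂ (divide (μ≉0 (RB i)) 1#)

    -- The fundamental relation Σ μ_i⁻¹ p(B_i) = L r = 0.
    relation : lincomb μ⁻¹ pB ≈ᵛ 0ᵛ
    relation t = trans (span-coefficients μ⁻¹ t)
                       (trans (lincomb-cong q G≈r t) (annihilated K t))
      where
      G≈r : ∀ u → G μ⁻¹ u ≈ r u
      G≈r u = trans (G-on-part μ⁻¹ (proj₁ (covers u)) (proj₂ (covers u)))
                    (inverse-cancel (r u) (μ⁻¹-inverse (proj₁ (covers u))))

    -- A relation among p(B_1), ..., p(B_{m+1}) is one among all p(B_i) with x_0 = 0,
    -- so every x_i μ_i equals 0·μ_0 = 0.
    independent : LinIndep basis
    independent x rel i = cancel-nonzeroʳ (μ≉0 (RB (Fin.suc i))) (trans (proj₂ uniform (Fin.suc i)) ν≈0)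
      where
      x̂ : Fin (suc (suc m)) → Carrier
      x̂ Fin.zero = 0#
      x̂ (Fin.suc j) = x j
      uniform : ∃ λ ν → ∀ j → x̂ j * μ (RB j) ≈ ν
      uniform = relation-uniform x̂ (λ t → trans (+-cong (zeroˡ _) (rel t)) (+-identityˡ 0#))
      ν≈0 : proj₁ uniform ≈ 0#
      ν≈0 = trans (sym (proj₂ uniform Fin.zero)) (zeroˡ _)

    first-inSpan : InSpan basis (pB Fin.zero)
    first-inSpan = (- μ (RB Fin.zero)) · (λ i → μ⁻¹ (Fin.suc i)) , λ t →
      trans (isolate (μ⁻¹-inverse Fin.zero) (relation t))
            (sym (lincomb-· (- μ (RB Fin.zero)) (λ i → μ⁻¹ (Fin.suc i)) basis t))

    blockDimension : HasProjDim pB m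
    blockDimension = basis , independent , (λ i → member-inSpan pB (Fin.suc i)) , spans
      where
      spans : ∀ j → InSpan basis (pB j)
      spans Fin.zero = first-inSpan
      spans (Fin.suc i) = member-inSpan basis i

  open LargeBlock using (blockDimension) public
  open Block using (notInSpan) public

  spanned-part : ∀ {s} → n ≡ k ℕ* suc s → (B : Fin (suc s) → Subset n) → IsBlock k (suc s) B →
    ∀ a → ∣ a ∣ ≡ k → InSpan (λ i → p (B i)) (p a) → ∃ λ i → a ≡ B i
  spanned-part n≡ks B blk a |a|≡k inSpan with any? (λ i → ≡-dec Bool._≟_ a (B i))
  ... | yes found = found
  ... | no none = ⊥-elim (notInSpan n≡ks B blk a |a|≡k (λ i a≡Bi → none (i , a≡Bi)) inSpan)

  sameSpan⇒sameParts : ∀ {s} → n ≡ k ℕ* suc s → (B B' : Fin (suc s) → Subset n) →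
    IsBlock k (suc s) B → IsBlock k (suc s) B' → SameSpan (λ i → p (B i)) (λ i → p (B' i)) →
    (∀ i → ∃ λ j → B i ≡ B' j) × (∀ j → ∃ λ i → B' j ≡ B i)
  sameSpan⇒sameParts n≡ks B B' blk blk' (B⊆span , B'⊆span) =
    (λ i → spanned-part n≡ks B' blk' (B i) (proj₁ blk i) (B⊆span i)) ,
    (λ j → spanned-part n≡ks B blk (B' j) (proj₁ blk' j) (B'⊆span j))

open import Data.Nat using (_*_)

proposition2p4 : ∀ {c ℓ : Level} (F : Field c ℓ) (k s : ℕ) →
  1 ≤ k → 2 ≤ s → 5 ≤ k * s →
  (q : Fin (k * s) → LinAlg.Vec F (k * s ∸ 1)) → LinAlg.IsFrame F q →
  (p : Subset (k * s) → LinAlg.Vec F (k * s ∸ 1)) →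
  (∀ a → ∣ a ∣ ≡ k → LinAlg.RepresentsP F q a (p a)) →
  ((B : Fin s → Subset (k * s)) → IsBlock k s B →
     LinAlg.HasProjDim F (λ i → p (B i)) (s ∸ 2))
  × ((B : Fin s → Subset (k * s)) → IsBlock k s B →
     (a : Subset (k * s)) → ∣ a ∣ ≡ k → (∀ i → a ≢ B i) →
     ¬ LinAlg.InSpan F (λ i → p (B i)) (p a))
  × ((B B' : Fin s → Subset (k * s)) → IsBlock k s B → IsBlock k s B' →
     LinAlg.SameSpan F (λ i → p (B i)) (λ i → p (B' i)) →
     (∀ i → ∃ λ j → B i ≡ B' j) × (∀ j → ∃ λ i → B' j ≡ B i))
proposition2p4 F k (suc (suc m)) k≥1 (s≤s (s≤s z≤n)) _ q frame p rep =
  blockDimension ≡.refl , notInSpan ≡.refl , sameSpan⇒sameParts ≡.refl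
  where open Configuration F q frame k k≥1 p rep
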